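{- For any $k\in\mathbb{N}$ there exists a hollow affine $(k-1)$-crystal $C\in\mathcal{T}^{\frac{k^2+k}{2}\cdot\mathbf{1}_k}(\mathbb{Z})$.
   Context: For $n,q\in\mathbb{N}$, $\mathcal{T}^{n\cdot\mathbf{1}_q}(\mathbb{Z})$ is the set of functions $C:[n]^q\to\mathbb{Z}$, where $[n]=\{1,\dots,n\}$. For a tuple $\mathbf{b}=(b_1,\dots,b_q)$ and $\mathbf{i}=(i_1,\dots,i_p)\in[q]^p$, $\mathbf{b}_{\mathbf{i}}=(b_{i_1},\dots,b_{i_p})$ (for $p=0$ this is the empty tuple, and $[n]^0$ has one element, the empty tuple). The projection of $C$ onto $\mathbf{i}\in[q]^p$ is $\Pi_{\mathbf{i}}*C:[n]^p\to\mathbb{Z}$, $(\Pi_{\mathbf{i}}*C)(\mathbf{a})=\sum_{\mathbf{b}\in[n]^q,\ \mathbf{b}_{\mathbf{i}}=\mathbf{a}}C(\mathbf{b})$. Let $[q]^h_\to$ be the set of strictly increasing tuples in $[q]^h$ (with $[q]^0_\to$ consisting of the empty tuple). For $h\in\{0,\dots,q\}$, $C$ is an $h$-crystal if $\Pi_{\mathbf{i}}*C=\Pi_{\mathbf{j}}*C$ for all $\mathbf{i},\mathbf{j}\in[q]^h_\to$. $C$ is affine if its entries sum to $1$. $C:[n]^q\to\mathbb{Z}$ is hollow if $C(\mathbf{a})=0$ for every $\mathbf{a}\in[n]^q$ whose entries are not pairwise distinct. -}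

module Defs where

open import Data.Nat using (ℕ; zero; suc)
open import Data.Fin using (Fin; _<_)
open import Data.Fin.Properties using (_≟_; all?)
open import Data.Integer using (ℤ; _+_; +_)
open import Data.Vec.Functional using (_∷_)
open import Data.Product using (∃₂; _×_)
open import Relation.Nullary using (¬_; does)
open import Relation.Binary.PropositionalEquality using (_≡_)
open import Data.Bool using (if_then_else_)

-- A tensor C ∈ T^{n·1_q}(ℤ): a function [n]^q → ℤ, with [n] = Fin n and
-- [n]^q = Fin q → Fin n.
Tensor : ℕ → ℕ → Set
Tensor n q = (Fin q → Fin n) → ℤ

sumFin : (n : ℕ) → (Fin n → ℤ) → ℤ
sumFin zero    f = + 0
sumFin (suc n) f = f Fin.zero + sumFin n (λ x → f (Fin.suc x))
  where import Data.Fin as Fin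

sumTuples : (n q : ℕ) → ((Fin q → Fin n) → ℤ) → ℤ
sumTuples n zero    f = f (λ ())
sumTuples n (suc q) f = sumFin n (λ x → sumTuples n q (λ t → f (x ∷ t)))

-- Projection Π_i * C for i ∈ [q]^p:
-- (Π_i * C)(a) = Σ_{b ∈ [n]^q, b_i = a} C(b), where b_i = b ∘ i.
proj : {n q p : ℕ} → (Fin p → Fin q) → Tensor n q → Tensor n p
proj {n} {q} {p} i C a =
  sumTuples n q (λ b → if does (all? (λ j → b (i j) ≟ a j)) then C b else + 0)

StrictlyIncreasing : {h q : ℕ} → (Fin h → Fin q) → Set
StrictlyIncreasing {h} i = ∀ (j j′ : Fin h) → j < j′ → i j < i j′

IsCrystal : {n q : ℕ} → (h : ℕ) → Tensor n q → Set
IsCrystal {n} {q} h C =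
  ∀ (i j : Fin h → Fin q) → StrictlyIncreasing i → StrictlyIncreasing j →
  ∀ (a : Fin h → Fin n) → proj i C a ≡ proj j C a

IsAffine : {n q : ℕ} → Tensor n q → Set
IsAffine {n} {q} C = sumTuples n q C ≡ + 1

IsHollow : {n q : ℕ} → Tensor n q → Set
IsHollow {n} {q} C =
  ∀ (a : Fin q → Fin n) → (∃₂ λ (x y : Fin q) → ¬ (x ≡ y) × a x ≡ a y) → C a ≡ + 0

-- The letters are the pairs (ℓ , p) with p < ℓ ≤ k, and a word of length m has the letter (m , j)
-- fixed when it stands at position j. The coefficient of a word is 1 for the empty word, 0 if no
-- letter is fixed, and otherwise (-1)^(c-1) times the coefficient of the word with its c fixed
-- letters removed. A letter whose level exceeds the length of the word is never removed, so it
-- forces coefficient 0; so does a repeated letter, since at most one of its copies is fixed.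
-- The key identity: summing the coefficient of u ++ x ∷ v over all letters x gives the
-- coefficient of u ++ v. With m = |u| + |v| + 1, only x = (m , |u|) is fixed at the insertion
-- point, and the removal factor it adds cancels the sum over the remaining letters (computed by
-- induction on the length) unless nothing else is fixed. A strictly increasing (k-1)-tuple of
-- coordinates omits exactly one coordinate, so every (k-1)-projection of the tensor is this
-- marginal, and iterating the identity shows that the entries sum to 1.
module Submission where

open import Defs
open import Data.Bool using (true; false; if_then_else_)
open import Data.Empty using (⊥-elim)
open import Data.Fin as Fin using (Fin; zero; suc; toℕ; punchIn; punchOut; splitAt; join; _↑ˡ_; _↑ʳ_; fromℕ<)
open import Data.Fin.Properties
  using (_≟_; all?; 0≢1+n; pigeonhole; punchIn-punchOut; punchInᵢ≢i; <-irrefl;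
         splitAt-↑ˡ; splitAt-↑ʳ; join-splitAt; toℕ-injective; toℕ-fromℕ<)
open import Data.Integer as ℤ using (ℤ; 0ℤ; 1ℤ; -1ℤ; _+_; _-_; _^_)
import Data.Integer.Properties as ℤ
open import Data.Integer.Tactic.RingSolver using (solve-∀)
open import Data.List using (List; []; _∷_; _++_; length; tabulate; take; drop)
open import Data.List.Membership.Propositional using (_∈_)
open import Data.List.Membership.Propositional.Properties using (∈-++⁺ˡ; ∈-++⁺ʳ; ∈-tabulate⁺)
open import Data.List.Properties using (length-++; tabulate-cong; length-tabulate; take++drop≡id)
open import Data.List.Relation.Unary.Any using (here; there)
open import Data.Nat as ℕ using (ℕ; zero; suc; z≤n; s≤s; _≤_; _<_; _*_; _∸_; _/_)
import Data.Nat.Properties as ℕ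
open import Data.Nat.DivMod using (m*n/n≡m)
open import Data.Nat.Induction using (<-rec)
import Data.Nat.Tactic.RingSolver as ℕ-Solver
open import Data.Product using (Σ; _×_; _,_; proj₁; proj₂; ∃-syntax)
open import Data.Product.Properties using (≡-dec)
open import Data.Sum using (_⊎_; inj₁; inj₂; [_,_]′)
open import Data.Vec.Functional as Vector using (insertAt; removeAt; replicate)
open import Data.Vec.Functional.Properties using (insertAt-punchIn; ∷-cong)
open import Function using (_∘_; id; case_of_)
open import Function.Bundles using (mk⇔)
open import Function.Definitions using (Injective)
open import Relation.Binary.Core using (_Preserves_⟶_)
open import Relation.Binary.Definitions using (DecidableEquality)
open import Relation.Binary.PropositionalEquality
open import Relation.Nullary using (Dec; yes; no; does; ¬_)
open import Relation.Nullary.Decidable using (dec-true; dec-false; does-⇔)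

open import Algebra.Properties.CommutativeSemigroup ℕ.+-commutativeSemigroup using (interchange)
open import Algebra.Properties.Semiring.Sum ℤ.+-*-semiring
  using (sum; sum-cong-≗; ∑-distrib-+; ∑-comm; *-distribˡ-sum; sum-remove; sum-replicate-zero)

-- Sums over Fin n and over tuples

sumFin≡sum : ∀ n (f : Fin n → ℤ) → sumFin n f ≡ sum f
sumFin≡sum zero    f = refl
sumFin≡sum (suc n) f = cong (f zero +_) (sumFin≡sum n (f ∘ suc))

sumFin-cong : ∀ n {f g : Fin n → ℤ} → f ≗ g → sumFin n f ≡ sumFin n g
sumFin-cong zero    f≗g = refl
sumFin-cong (suc n) f≗g = cong₂ _+_ (f≗g zero) (sumFin-cong n (f≗g ∘ suc))

sumFin-zero : ∀ n → sumFin n (λ _ → 0ℤ) ≡ 0ℤ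
sumFin-zero n = trans (sumFin≡sum n (replicate n 0ℤ)) (sum-replicate-zero n)

sumFin-distrib-+ : ∀ n (f g : Fin n → ℤ) → sumFin n (λ x → f x + g x) ≡ sumFin n f + sumFin n g
sumFin-distrib-+ n f g = begin
  sumFin n (λ x → f x + g x) ≡⟨ sumFin≡sum n _ ⟩
  sum (λ x → f x + g x)      ≡⟨ ∑-distrib-+ f g ⟩
  sum f + sum g              ≡⟨ cong₂ _+_ (sumFin≡sum n f) (sumFin≡sum n g) ⟨
  sumFin n f + sumFin n g    ∎
  where open ≡-Reasoning

*-distribˡ-sumFin : ∀ n c (f : Fin n → ℤ) → sumFin n (λ x → c ℤ.* f x) ≡ c ℤ.* sumFin n f
*-distribˡ-sumFin n c f = begin
  sumFin n (λ x → c ℤ.* f x) ≡⟨ sumFin≡sum n _ ⟩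
  sum (λ x → c ℤ.* f x)      ≡⟨ *-distribˡ-sum c f ⟨
  c ℤ.* sum f                ≡⟨ cong (c ℤ.*_) (sumFin≡sum n f) ⟨
  c ℤ.* sumFin n f           ∎
  where open ≡-Reasoning

sumFin-comm : ∀ m n (f : Fin m → Fin n → ℤ) →
  sumFin m (λ x → sumFin n (f x)) ≡ sumFin n (λ y → sumFin m (λ x → f x y))
sumFin-comm m n f = begin
  sumFin m (λ x → sumFin n (f x))         ≡⟨ sumFin≡sum m _ ⟩
  sum (λ x → sumFin n (f x))              ≡⟨ sum-cong-≗ (λ x → sumFin≡sum n (f x)) ⟩
  sum (λ x → sum (f x))                   ≡⟨ ∑-comm f ⟩
  sum (λ y → sum (λ x → f x y))           ≡⟨ sum-cong-≗ (λ y → sumFin≡sum m (λ x → f x y)) ⟨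
  sum (λ y → sumFin m (λ x → f x y))      ≡⟨ sumFin≡sum n _ ⟨
  sumFin n (λ y → sumFin m (λ x → f x y)) ∎
  where open ≡-Reasoning

sumFin-δ : ∀ n (y : Fin n) (f : Fin n → ℤ) → sumFin n (λ x → if does (x ≟ y) then f x else 0ℤ) ≡ f y
sumFin-δ (suc n) y f = begin
  sumFin (suc n) δf                ≡⟨ sumFin≡sum (suc n) δf ⟩
  sum δf                           ≡⟨ sum-remove {i = y} δf ⟩
  δf y + sum (removeAt δf y)       ≡⟨ cong₂ _+_ δf-at-y (sum-cong-≗ δf-elsewhere) ⟩
  f y + sum (replicate n 0ℤ)       ≡⟨ cong (f y +_) (sum-replicate-zero n) ⟩
  f y + 0ℤ                         ≡⟨ ℤ.+-identityʳ (f y) ⟩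
  f y                              ∎
  where
  open ≡-Reasoning
  δf : Fin (suc n) → ℤ
  δf x = if does (x ≟ y) then f x else 0ℤ
  δf-at-y : δf y ≡ f y
  δf-at-y rewrite dec-true (y ≟ y) refl = refl
  δf-elsewhere : removeAt δf y ≗ replicate n 0ℤ
  δf-elsewhere j rewrite dec-false (punchIn y j ≟ y) (punchInᵢ≢i y j) = refl

sumFin-update : ∀ n (y : Fin n) a (f : Fin n → ℤ) →
  sumFin n (λ x → if does (x ≟ y) then a else f x) ≡ (a - f y) + sumFin n f
sumFin-update n y a f = begin
  sumFin n (λ x → if does (x ≟ y) then a else f x)
    ≡⟨ sumFin-cong n split ⟩
  sumFin n (λ x → f x + (if does (x ≟ y) then a - f x else 0ℤ))
    ≡⟨ sumFin-distrib-+ n f _ ⟩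
  sumFin n f + sumFin n (λ x → if does (x ≟ y) then a - f x else 0ℤ)
    ≡⟨ cong (sumFin n f +_) (sumFin-δ n y (λ x → a - f x)) ⟩
  sumFin n f + (a - f y)
    ≡⟨ ℤ.+-comm (sumFin n f) (a - f y) ⟩
  (a - f y) + sumFin n f ∎
  where
  open ≡-Reasoning
  a≡b+[a-b] : ∀ a b → a ≡ b + (a - b)
  a≡b+[a-b] = solve-∀
  split : ∀ x → (if does (x ≟ y) then a else f x) ≡ f x + (if does (x ≟ y) then a - f x else 0ℤ)
  split x with does (x ≟ y)
  ... | true  = a≡b+[a-b] a (f x)
  ... | false = sym (ℤ.+-identityʳ (f x))

-- The test in proj i C a is definitionally (b ∘ i) ≗? a.
_≗?_ : ∀ {n q} (b a : Fin q → Fin n) → Dec (b ≗ a)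
b ≗? a = all? (λ j → b j ≟ a j)

module _ {n : ℕ} where

  sumTuples-cong : ∀ q {f g : (Fin q → Fin n) → ℤ} → f ≗ g → sumTuples n q f ≡ sumTuples n q g
  sumTuples-cong zero    f≗g = f≗g _
  sumTuples-cong (suc q) f≗g = sumFin-cong n (λ x → sumTuples-cong q (λ t → f≗g (x Vector.∷ t)))

  sumTuples-zero : ∀ q → sumTuples n q (λ _ → 0ℤ) ≡ 0ℤ
  sumTuples-zero zero    = refl
  sumTuples-zero (suc q) = trans (sumFin-cong n (λ _ → sumTuples-zero q)) (sumFin-zero n)

  sumFin-sumTuples-comm : ∀ m q (f : Fin m → (Fin q → Fin n) → ℤ) →
    sumFin m (λ x → sumTuples n q (f x)) ≡ sumTuples n q (λ t → sumFin m (λ x → f x t))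
  sumFin-sumTuples-comm m zero    f = refl
  sumFin-sumTuples-comm m (suc q) f =
    trans (sumFin-comm m n _) (sumFin-cong n (λ y → sumFin-sumTuples-comm m q (λ x t → f x (y Vector.∷ t))))

  sumTuples-insertAt : ∀ q (r : Fin (suc q)) (f : (Fin (suc q) → Fin n) → ℤ) → f Preserves _≗_ ⟶ _≡_ →
    sumTuples n (suc q) f ≡ sumFin n (λ x → sumTuples n q (λ t → f (insertAt t r x)))
  sumTuples-insertAt q zero f f-resp =
    sumFin-cong n (λ x → sumTuples-cong q (λ t → f-resp (∷-cong refl (λ _ → refl))))
  sumTuples-insertAt (suc q) (suc r) f f-resp =
    trans (sumFin-cong n (λ y → sumTuples-insertAt q r (f ∘ (y Vector.∷_)) (f-resp ∘ ∷-cong refl)))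
          (trans (sumFin-comm n n _) (sumFin-cong n (λ x → sumFin-cong n (λ y →
                   sumTuples-cong q (λ t → f-resp (∷-cong refl (λ _ → refl)))))))

  sumTuples-δ : ∀ q (a : Fin q → Fin n) (g : (Fin q → Fin n) → ℤ) → g Preserves _≗_ ⟶ _≡_ →
    sumTuples n q (λ t → if does (t ≗? a) then g t else 0ℤ) ≡ g a
  sumTuples-δ zero    a g g-resp = g-resp (λ ())
  sumTuples-δ (suc q) a g g-resp =
    trans (sumFin-cong n (λ y → δ-head y (y ≟ a zero)))
          (trans (sumFin-δ n (a zero) _) (g-resp (∷-cong refl (λ _ → refl))))
    where
    δ-head : ∀ y (y≟a₀ : Dec (y ≡ a zero)) →
      sumTuples n q (λ t → if does ((y Vector.∷ t) ≗? a) then g (y Vector.∷ t) else 0ℤ)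
        ≡ (if does y≟a₀ then g (y Vector.∷ (a ∘ suc)) else 0ℤ)
    δ-head y (yes y≡a₀) =
      trans (sumTuples-cong q (λ t → cong (λ b → if b then g (y Vector.∷ t) else 0ℤ)
              (does-⇔ (mk⇔ (_∘ suc) (∷-cong y≡a₀)) ((y Vector.∷ t) ≗? a) (t ≗? (a ∘ suc)))))
            (sumTuples-δ q (a ∘ suc) (g ∘ (y Vector.∷_)) (g-resp ∘ ∷-cong refl))
    δ-head y (no y≢a₀) =
      trans (sumTuples-cong q (λ t → cong (λ b → if b then g (y Vector.∷ t) else 0ℤ)
              (dec-false ((y Vector.∷ t) ≗? a) (λ y∷t≗a → y≢a₀ (y∷t≗a zero)))))
            (sumTuples-zero q)

insertAt-cong : ∀ {A : Set} {m} {t t′ : Fin m → A} → t ≗ t′ → ∀ r x → insertAt t r x ≗ insertAt t′ r x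
insertAt-cong t≗t′ zero x zero = refl
insertAt-cong t≗t′ zero x (suc j) = t≗t′ j
insertAt-cong {m = suc m} t≗t′ (suc r) x zero = t≗t′ zero
insertAt-cong {m = suc m} t≗t′ (suc r) x (suc j) = insertAt-cong (t≗t′ ∘ suc) r x j

does-≗?-cong : ∀ {n q} {b b′ : Fin q → Fin n} → b ≗ b′ → ∀ a → does (b ≗? a) ≡ does (b′ ≗? a)
does-≗?-cong {b = b} {b′} b≗b′ a =
  does-⇔ (mk⇔ (λ b≗a j → trans (sym (b≗b′ j)) (b≗a j)) (λ b′≗a j → trans (b≗b′ j) (b′≗a j)))
         (b ≗? a) (b′ ≗? a)

proj-cong : ∀ {n q p} {i j : Fin p → Fin q} (C : Tensor n q) → i ≗ j → ∀ a → proj i C a ≡ proj j C a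
proj-cong {q = q} C i≗j a = sumTuples-cong q (λ b →
  cong (λ t → if t then C b else 0ℤ) (does-≗?-cong (cong b ∘ i≗j) a))

proj-punchIn : ∀ {n m} (C : Tensor n (suc m)) → C Preserves _≗_ ⟶ _≡_ →
  ∀ r a → proj (punchIn r) C a ≡ sumFin n (λ x → C (insertAt a r x))
proj-punchIn {n} {m} C C-resp r a = begin
  proj (punchIn r) C a
    ≡⟨ sumTuples-insertAt m r _ restriction-resp ⟩
  sumFin n (λ x → sumTuples n m (λ t →
    if does ((insertAt t r x ∘ punchIn r) ≗? a) then C (insertAt t r x) else 0ℤ))
    ≡⟨ sumFin-cong n (λ x → sumTuples-cong m (λ t →
         cong (λ b → if b then C (insertAt t r x) else 0ℤ) (does-≗?-cong (insertAt-punchIn t r x) a))) ⟩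
  sumFin n (λ x → sumTuples n m (λ t → if does (t ≗? a) then C (insertAt t r x) else 0ℤ))
    ≡⟨ sumFin-cong n (λ x →
         sumTuples-δ m a (λ t → C (insertAt t r x)) (λ t≗t′ → C-resp (insertAt-cong t≗t′ r x))) ⟩
  sumFin n (λ x → C (insertAt a r x)) ∎
  where
  open ≡-Reasoning
  restriction-resp : (λ b → if does ((b ∘ punchIn r) ≗? a) then C b else 0ℤ) Preserves _≗_ ⟶ _≡_
  restriction-resp b≗b′ =
    cong₂ (λ t c → if t then c else 0ℤ) (does-≗?-cong (b≗b′ ∘ punchIn r) a) (C-resp b≗b′)

-- Strictly increasing maps

private
  variable
    p q : ℕ

strictlyIncreasing-lower : (f : Fin p → Fin (suc q)) → (∀ j → zero ≢ f j) → StrictlyIncreasing f →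
  ∃[ g ] StrictlyIncreasing g × f ≗ suc ∘ g
strictlyIncreasing-lower {p = p} {q = q} f 0∉f f↑ = g , g↑ , f≗suc∘g
  where
  g : Fin p → Fin q
  g j = punchOut (0∉f j)
  f≗suc∘g : f ≗ suc ∘ g
  f≗suc∘g j = sym (punchIn-punchOut (0∉f j))
  g↑ : StrictlyIncreasing g
  g↑ j j′ j<j′ = ℕ.s<s⁻¹ (subst₂ Fin._<_ (f≗suc∘g j) (f≗suc∘g j′) (f↑ j j′ j<j′))

strictlyIncreasing-suc≢0 : (f : Fin (suc p) → Fin (suc q)) → StrictlyIncreasing f → ∀ j → zero ≢ f (suc j)
strictlyIncreasing-suc≢0 f f↑ j 0≡fj =
  ℕ.n≮0 (subst (f zero Fin.<_) (sym 0≡fj) (f↑ zero (suc j) (s≤s z≤n)))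

strictlyIncreasing-tail : (f : Fin (suc p) → Fin (suc q)) → StrictlyIncreasing f →
  ∃[ g ] StrictlyIncreasing g × f ∘ suc ≗ suc ∘ g
strictlyIncreasing-tail f f↑ =
  strictlyIncreasing-lower (f ∘ suc) (strictlyIncreasing-suc≢0 f f↑) (λ j j′ → f↑ (suc j) (suc j′) ∘ s≤s)

strictlyIncreasing-zero-or-suc : (f : Fin (suc p) → Fin (suc q)) → StrictlyIncreasing f →
  (f zero ≡ zero × ∃[ g ] StrictlyIncreasing g × f ∘ suc ≗ suc ∘ g)
  ⊎ (∃[ g ] StrictlyIncreasing g × f ≗ suc ∘ g)
strictlyIncreasing-zero-or-suc f f↑ with f zero in f0≡
... | zero  = inj₁ (refl , strictlyIncreasing-tail f f↑)
... | suc _ = inj₂ (strictlyIncreasing-lower f 0∉f f↑)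
  where
  0∉f : ∀ j → zero ≢ f j
  0∉f zero    0≡f0 = 0≢1+n (trans 0≡f0 f0≡)
  0∉f (suc j) = strictlyIncreasing-suc≢0 f f↑ j

¬strictlyIncreasing-shrink : (f : Fin (suc p) → Fin p) → ¬ StrictlyIncreasing f
¬strictlyIncreasing-shrink {p = p} f f↑ with pigeonhole (ℕ.n<1+n p) f
... | i , j , i<j , fi≡fj = <-irrefl fi≡fj (f↑ i j i<j)

strictlyIncreasing-endo : (f : Fin p → Fin p) → StrictlyIncreasing f → f ≗ id
strictlyIncreasing-endo {p = suc p} f f↑ with strictlyIncreasing-zero-or-suc f f↑
... | inj₁ (f0≡0 , g , g↑ , f∘suc≗suc∘g) = λ where
  zero    → f0≡0
  (suc j) → trans (f∘suc≗suc∘g j) (cong suc (strictlyIncreasing-endo g g↑ j))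
... | inj₂ (g , g↑ , _) = ⊥-elim (¬strictlyIncreasing-shrink g g↑)

strictlyIncreasing⇒punchIn : ∀ {m} (i : Fin m → Fin (suc m)) → StrictlyIncreasing i → ∃[ r ] i ≗ punchIn r
strictlyIncreasing⇒punchIn {zero}  i i↑ = zero , λ ()
strictlyIncreasing⇒punchIn {suc m} i i↑ with strictlyIncreasing-zero-or-suc i i↑
... | inj₁ (i0≡0 , g , g↑ , i∘suc≗suc∘g) =
  let r , g≗punchIn = strictlyIncreasing⇒punchIn g g↑ in
  suc r , λ where
    zero    → i0≡0
    (suc j) → trans (i∘suc≗suc∘g j) (cong suc (g≗punchIn j))
... | inj₂ (g , g↑ , i≗suc∘g) = zero , λ j → trans (i≗suc∘g j) (cong suc (strictlyIncreasing-endo g g↑ j))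

-- Words and their coefficients

Letter : Set
Letter = ℕ × ℕ

level : Letter → ℕ
level = proj₁

_≟ᴸ_ : DecidableEquality Letter
_≟ᴸ_ = ≡-dec ℕ._≟_ ℕ._≟_

Word : Set
Word = List Letter

data HasDuplicate : Word → Set where
  head∈tail : ∀ {a w} → a ∈ w → HasDuplicate (a ∷ w)
  in-tail   : ∀ {a w} → HasDuplicate w → HasDuplicate (a ∷ w)

-- The letter (m , j) is fixed when it sits at position j; positions are numbered from i.
fixedCount : ℕ → ℕ → Word → ℕ
fixedCount m i []      = 0
fixedCount m i (a ∷ w) = if does (a ≟ᴸ (m , i)) then suc (fixedCount m (suc i) w) else fixedCount m (suc i) w

dropFixed : ℕ → ℕ → Word → Word
dropFixed m i []      = []
dropFixed m i (a ∷ w) = if does (a ≟ᴸ (m , i)) then dropFixed m (suc i) w else a ∷ dropFixed m (suc i) w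

module _ (m : ℕ) where

  length-dropFixed : ∀ i w → length (dropFixed m i w) ℕ.+ fixedCount m i w ≡ length w
  length-dropFixed i []      = refl
  length-dropFixed i (a ∷ w) with a ≟ᴸ (m , i)
  ... | yes _ = trans (ℕ.+-suc _ _) (cong suc (length-dropFixed (suc i) w))
  ... | no  _ = cong suc (length-dropFixed (suc i) w)

  dropFixed-shorter : ∀ i w → 0 < fixedCount m i w → length (dropFixed m i w) < length w
  dropFixed-shorter i w 0<c = subst (length (dropFixed m i w) <_) (length-dropFixed i w) (ℕ.m<m+n _ 0<c)

  dropFixed-none : ∀ i w → fixedCount m i w ≡ 0 → dropFixed m i w ≡ w
  dropFixed-none i []      _  = refl
  dropFixed-none i (a ∷ w) c≡0 with a ≟ᴸ (m , i)
  ... | yes _ = ⊥-elim (ℕ.1+n≢0 c≡0)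
  ... | no  _ = cong (a ∷_) (dropFixed-none (suc i) w c≡0)

  fixedCount-level : ∀ i w → 0 < fixedCount m i w → ∃[ L ] L ∈ w × level L ≡ m
  fixedCount-level i (a ∷ w) 0<c with a ≟ᴸ (m , i)
  ... | yes a≡ = a , here refl , cong level a≡
  ... | no  _  = let L , L∈w , lvl = fixedCount-level (suc i) w 0<c in L , there L∈w , lvl

  ∈-dropFixed : ∀ {L} i w → L ∈ w → L ∈ dropFixed m i w ⊎ ∃[ j ] i ≤ j × L ≡ (m , j)
  ∈-dropFixed i (a ∷ w) (here L≡a) with a ≟ᴸ (m , i)
  ... | yes a≡ = inj₂ (i , ℕ.≤-refl , trans L≡a a≡)
  ... | no  _  = inj₁ (here L≡a)
  ∈-dropFixed i (a ∷ w) (there L∈w) with a ≟ᴸ (m , i) | ∈-dropFixed (suc i) w L∈w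
  ... | yes _ | inj₁ L∈ = inj₁ L∈
  ... | no  _ | inj₁ L∈ = inj₁ (there L∈)
  ... | _     | inj₂ (j , i<j , L≡) = inj₂ (j , ℕ.<⇒≤ i<j , L≡)

  ∈-dropFixed-level : ∀ {L} i w → L ∈ w → level L ≢ m → L ∈ dropFixed m i w
  ∈-dropFixed-level i w L∈w lvl≢m with ∈-dropFixed i w L∈w
  ... | inj₁ L∈ = L∈
  ... | inj₂ (_ , _ , L≡) = ⊥-elim (lvl≢m (cong level L≡))

  dropFixed-duplicate : ∀ i w → HasDuplicate w →
    HasDuplicate (dropFixed m i w) ⊎ ∃[ L ] L ∈ dropFixed m i w × level L ≡ m
  dropFixed-duplicate i (a ∷ w) (head∈tail a∈w) with a ≟ᴸ (m , i) | ∈-dropFixed (suc i) w a∈w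
  ... | yes a≡ | inj₁ a∈ = inj₂ (a , a∈ , cong level a≡)
  ... | yes a≡ | inj₂ (j , i<j , a≡′) = ⊥-elim (ℕ.<-irrefl (cong proj₂ (trans (sym a≡) a≡′)) i<j)
  ... | no  _  | inj₁ a∈ = inj₁ (head∈tail a∈)
  ... | no  _  | inj₂ (_ , _ , a≡′) = inj₂ (a , here refl , cong level a≡′)
  dropFixed-duplicate i (a ∷ w) (in-tail dup) with a ≟ᴸ (m , i) | dropFixed-duplicate (suc i) w dup
  ... | yes _ | inj₁ dup′ = inj₁ dup′
  ... | no  _ | inj₁ dup′ = inj₁ (in-tail dup′)
  ... | yes _ | inj₂ (L , L∈ , lvl) = inj₂ (L , L∈ , lvl)
  ... | no  _ | inj₂ (L , L∈ , lvl) = inj₂ (L , there L∈ , lvl)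

  fixedCount-++ : ∀ i u v → fixedCount m i (u ++ v) ≡ fixedCount m i u ℕ.+ fixedCount m (i ℕ.+ length u) v
  fixedCount-++ i []      v rewrite ℕ.+-identityʳ i = refl
  fixedCount-++ i (a ∷ u) v rewrite ℕ.+-suc i (length u) with a ≟ᴸ (m , i)
  ... | yes _ = cong suc (fixedCount-++ (suc i) u v)
  ... | no  _ = fixedCount-++ (suc i) u v

  dropFixed-++ : ∀ i u v → dropFixed m i (u ++ v) ≡ dropFixed m i u ++ dropFixed m (i ℕ.+ length u) v
  dropFixed-++ i []      v rewrite ℕ.+-identityʳ i = refl
  dropFixed-++ i (a ∷ u) v rewrite ℕ.+-suc i (length u) with a ≟ᴸ (m , i)
  ... | yes _ = dropFixed-++ (suc i) u v
  ... | no  _ = cong (a ∷_) (dropFixed-++ (suc i) u v)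

removalFactor : ℕ → ℤ → ℤ
removalFactor zero    _ = 0ℤ
removalFactor (suc c) v = -1ℤ ^ c ℤ.* v

removalFactor-cong : ∀ c {v v′} → (0 < c → v ≡ v′) → removalFactor c v ≡ removalFactor c v′
removalFactor-cong zero    _    = refl
removalFactor-cong (suc c) v≡v′ = cong (-1ℤ ^ c ℤ.*_) (v≡v′ (s≤s z≤n))

removalFactor-zeroʳ : ∀ c → removalFactor c 0ℤ ≡ 0ℤ
removalFactor-zeroʳ zero    = refl
removalFactor-zeroʳ (suc c) = ℤ.*-zeroʳ (-1ℤ ^ c)

removalFactor-vanishes : ∀ c {v} → (0 < c → v ≡ 0ℤ) → removalFactor c v ≡ 0ℤ
removalFactor-vanishes c v≡0 = trans (removalFactor-cong c v≡0) (removalFactor-zeroʳ c)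

-- Removal shortens the word, so fuel = length suffices; the clause for zero fuel is never reached.
coefficientWithFuel : ℕ → Word → ℤ
coefficientWithFuel _       []          = 1ℤ
coefficientWithFuel zero    (_ ∷ _)     = 0ℤ
coefficientWithFuel (suc f) w@(_ ∷ _) =
  removalFactor (fixedCount (length w) 0 w) (coefficientWithFuel f (dropFixed (length w) 0 w))

coefficient : Word → ℤ
coefficient w = coefficientWithFuel (length w) w

coefficientWithFuel-irrelevant : ∀ f f′ w → length w ≤ f → length w ≤ f′ →
  coefficientWithFuel f w ≡ coefficientWithFuel f′ w
coefficientWithFuel-irrelevant zero    zero     []      _ _ = refl
coefficientWithFuel-irrelevant zero    (suc _)  []      _ _ = refl
coefficientWithFuel-irrelevant (suc _) zero     []      _ _ = refl
coefficientWithFuel-irrelevant (suc _) (suc _)  []      _ _ = refl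
coefficientWithFuel-irrelevant (suc f) (suc f′) w@(_ ∷ _) (s≤s w≤f) (s≤s w≤f′) =
  removalFactor-cong (fixedCount (length w) 0 w) λ 0<c →
    let shorter = ℕ.≤-pred (dropFixed-shorter (length w) 0 w 0<c) in
    coefficientWithFuel-irrelevant f f′ (dropFixed (length w) 0 w)
      (ℕ.≤-trans shorter w≤f) (ℕ.≤-trans shorter w≤f′)

coefficient-unfold : ∀ {m} w → length w ≡ suc m →
  coefficient w ≡ removalFactor (fixedCount (suc m) 0 w) (coefficient (dropFixed (suc m) 0 w))
coefficient-unfold w@(_ ∷ w′) refl =
  removalFactor-cong (fixedCount (length w) 0 w) λ 0<c →
    coefficientWithFuel-irrelevant (length w′) _ (dropFixed (length w) 0 w)
      (ℕ.≤-pred (dropFixed-shorter (length w) 0 w 0<c)) ℕ.≤-refl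

coefficientWithFuel-high-level : ∀ f w {L} → length w ≤ f → L ∈ w → length w < level L →
  coefficientWithFuel f w ≡ 0ℤ
coefficientWithFuel-high-level (suc f) w@(_ ∷ _) (s≤s w≤f) L∈w w<L =
  removalFactor-vanishes (fixedCount (length w) 0 w) λ 0<c →
    let shorter = dropFixed-shorter (length w) 0 w 0<c in
    coefficientWithFuel-high-level f (dropFixed (length w) 0 w) (ℕ.≤-trans (ℕ.≤-pred shorter) w≤f)
      (∈-dropFixed-level (length w) 0 w L∈w (ℕ.>⇒≢ w<L)) (ℕ.<-trans shorter w<L)

coefficient-high-level : ∀ w {L} → L ∈ w → length w < level L → coefficient w ≡ 0ℤ
coefficient-high-level w = coefficientWithFuel-high-level (length w) w ℕ.≤-refl

coefficientWithFuel-duplicate : ∀ f w → length w ≤ f → HasDuplicate w → coefficientWithFuel f w ≡ 0ℤ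
coefficientWithFuel-duplicate (suc f) w@(_ ∷ _) (s≤s w≤f) dup =
  removalFactor-vanishes (fixedCount (length w) 0 w) λ 0<c →
    let shorter = dropFixed-shorter (length w) 0 w 0<c
        w′≤f = ℕ.≤-trans (ℕ.≤-pred shorter) w≤f in
    case dropFixed-duplicate (length w) 0 w dup of λ where
      (inj₁ dup′) → coefficientWithFuel-duplicate f (dropFixed (length w) 0 w) w′≤f dup′
      (inj₂ (L , L∈ , refl)) → coefficientWithFuel-high-level f (dropFixed (length w) 0 w) w′≤f L∈ shorter

coefficient-duplicate : ∀ w → HasDuplicate w → coefficient w ≡ 0ℤ
coefficient-duplicate w = coefficientWithFuel-duplicate (length w) w ℕ.≤-refl

length-++-∷ : ∀ (u v : Word) L → length (u ++ L ∷ v) ≡ suc (length u ℕ.+ length v)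
length-++-∷ u v L = trans (length-++ u) (ℕ.+-suc (length u) (length v))

module Insertion (u v : Word) where

  -- In u ++ L ∷ v, c counts the fixed letters other than the one at position r, and removing
  -- them leaves u′ ++ L ∷ v′.
  m r c : ℕ
  m = suc (length u ℕ.+ length v)
  r = length u
  c = fixedCount m 0 u ℕ.+ fixedCount m (suc r) v

  u′ v′ : Word
  u′ = dropFixed m 0 u
  v′ = dropFixed m (suc r) v

  private
    split-at-L : ∀ L →
      removalFactor (fixedCount m 0 u ℕ.+ fixedCount m r (L ∷ v)) (coefficient (u′ ++ dropFixed m r (L ∷ v))) ≡
      (if does (L ≟ᴸ (m , r)) then removalFactor (suc c) (coefficient (u′ ++ v′))
                              else removalFactor c (coefficient (u′ ++ L ∷ v′)))
    split-at-L L with L ≟ᴸ (m , r)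
    ... | yes _ = cong (λ k → removalFactor k (coefficient (u′ ++ v′))) (ℕ.+-suc (fixedCount m 0 u) _)
    ... | no  _ = refl

  coefficient-insert : ∀ L → coefficient (u ++ L ∷ v) ≡
    (if does (L ≟ᴸ (m , r)) then removalFactor (suc c) (coefficient (u′ ++ v′))
                            else removalFactor c (coefficient (u′ ++ L ∷ v′)))
  coefficient-insert L = begin
    coefficient (u ++ L ∷ v)
      ≡⟨ coefficient-unfold (u ++ L ∷ v) (length-++-∷ u v L) ⟩
    removalFactor (fixedCount m 0 (u ++ L ∷ v)) (coefficient (dropFixed m 0 (u ++ L ∷ v)))
      ≡⟨ cong₂ (λ k w → removalFactor k (coefficient w))
               (fixedCount-++ m 0 u (L ∷ v)) (dropFixed-++ m 0 u (L ∷ v)) ⟩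
    removalFactor (fixedCount m 0 u ℕ.+ fixedCount m r (L ∷ v)) (coefficient (u′ ++ dropFixed m r (L ∷ v)))
      ≡⟨ split-at-L L ⟩
    (if does (L ≟ᴸ (m , r)) then removalFactor (suc c) (coefficient (u′ ++ v′))
                            else removalFactor c (coefficient (u′ ++ L ∷ v′))) ∎
    where open ≡-Reasoning

  residual-length : (length u′ ℕ.+ length v′) ℕ.+ c ≡ length u ℕ.+ length v
  residual-length = trans (interchange (length u′) (length v′) (fixedCount m 0 u) (fixedCount m (suc r) v))
                          (cong₂ ℕ._+_ (length-dropFixed m 0 u) (length-dropFixed m (suc r) v))

  residual-shorter : 0 < c → length u′ ℕ.+ length v′ < length u ℕ.+ length v
  residual-shorter 0<c = subst (length u′ ℕ.+ length v′ <_) residual-length (ℕ.m<m+n _ 0<c)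

  no-fixed : c ≡ 0 → u′ ++ v′ ≡ u ++ v
  no-fixed c≡0 = cong₂ _++_ (dropFixed-none m 0 u (ℕ.m+n≡0⇒m≡0 _ c≡0))
                            (dropFixed-none m (suc r) v (ℕ.m+n≡0⇒n≡0 _ c≡0))

  fixed-letter : 0 < c → ∃[ L ] L ∈ u ++ v × level L ≡ m
  fixed-letter 0<c with fixedCount m 0 u in cu≡
  ... | suc _ = let L , L∈u , lvl = fixedCount-level m 0 u (subst (0 <_) (sym cu≡) ℕ.z<s)
                in L , ∈-++⁺ˡ L∈u , lvl
  ... | zero  = let L , L∈v , lvl = fixedCount-level m (suc r) v 0<c in L , ∈-++⁺ʳ u L∈v , lvl

  coefficient-fixed : 0 < c → coefficient (u ++ v) ≡ 0ℤ
  coefficient-fixed 0<c with fixed-letter 0<c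
  ... | L , L∈ , refl = coefficient-high-level (u ++ v) L∈ (subst (_< m) (sym (length-++ u)) ℕ.≤-refl)

  coefficient-residual-fixed : 0 < c → coefficient (u′ ++ (m , r) ∷ v′) ≡ 0ℤ
  coefficient-residual-fixed 0<c = coefficient-high-level (u′ ++ (m , r) ∷ v′) (∈-++⁺ʳ u′ (here refl))
    (subst (_< m) (sym (length-++-∷ u′ v′ (m , r))) (ℕ.s<s (residual-shorter 0<c)))

sumFin-removalFactor : ∀ n k (f : Fin n → ℤ) →
  sumFin n (λ x → removalFactor k (f x)) ≡ removalFactor k (sumFin n f)
sumFin-removalFactor n zero    f = sumFin-zero n
sumFin-removalFactor n (suc k) f = *-distribˡ-sumFin n (-1ℤ ^ k) f

removalFactor-alternating : ∀ k X T → (k ≡ 0 → X ≡ T) → (0 < k → T ≡ 0ℤ) →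
  (removalFactor (suc k) X - removalFactor k 0ℤ) + removalFactor k X ≡ T
removalFactor-alternating zero    X T X≡T _   = trans (one X) (X≡T refl)
  where
  one : ∀ X → (1ℤ ℤ.* X - 0ℤ) + 0ℤ ≡ X
  one = solve-∀
removalFactor-alternating (suc k) X T _   T≡0 = trans (cancel (-1ℤ ^ k) X) (sym (T≡0 ℕ.z<s))
  where
  cancel : ∀ s X → ((-1ℤ ℤ.* s) ℤ.* X - s ℤ.* 0ℤ) + s ℤ.* X ≡ 0ℤ
  cancel = solve-∀

module FromAlphabet {n K : ℕ} (letter : Fin n → Letter) (letter-injective : Injective _≡_ _≡_ letter)
                (letter-onto : ∀ {ℓ p} → p < ℓ → ℓ ≤ K → ∃[ x ] letter x ≡ (ℓ , p)) where

  sumFin-letter-update : ∀ {ℓ p} → p < ℓ → ℓ ≤ K → ∀ a (f : Letter → ℤ) →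
    sumFin n (λ x → if does (letter x ≟ᴸ (ℓ , p)) then a else f (letter x))
      ≡ (a - f (ℓ , p)) + sumFin n (f ∘ letter)
  sumFin-letter-update p<ℓ ℓ≤K a f with letter-onto p<ℓ ℓ≤K
  ... | y , refl = trans (sumFin-cong n (λ x → cong (λ b → if b then a else f (letter x)) (does-letter≟ x)))
                         (sumFin-update n y a (f ∘ letter))
    where
    does-letter≟ : ∀ x → does (letter x ≟ᴸ letter y) ≡ does (x ≟ y)
    does-letter≟ x = does-⇔ (mk⇔ letter-injective (cong letter)) (letter x ≟ᴸ letter y) (x ≟ y)

  private
    MarginalAt : ℕ → Set
    MarginalAt s = ∀ u v → length u ℕ.+ length v ≡ s → s < K →
      sumFin n (λ x → coefficient (u ++ letter x ∷ v)) ≡ coefficient (u ++ v)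

    marginal-step : ∀ s → (∀ {s′} → s′ < s → MarginalAt s′) → MarginalAt s
    marginal-step _ IH u v refl u+v<K = begin
      sumFin n (λ x → coefficient (u ++ letter x ∷ v))
        ≡⟨ sumFin-cong n (coefficient-insert ∘ letter) ⟩
      sumFin n (λ x → if does (letter x ≟ᴸ (m , r)) then A else B (letter x))
        ≡⟨ sumFin-letter-update (s≤s (ℕ.m≤m+n r (length v))) u+v<K A B ⟩
      (A - B (m , r)) + sumFin n (B ∘ letter)
        ≡⟨ cong₂ (λ b Σb → (A - b) + Σb)
                 (removalFactor-cong c coefficient-residual-fixed) (sumFin-removalFactor n c _) ⟩
      (A - removalFactor c 0ℤ) + removalFactor c (sumFin n (λ x → coefficient (u′ ++ letter x ∷ v′)))
        ≡⟨ cong ((A - removalFactor c 0ℤ) +_) (removalFactor-cong c (λ 0<c →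
             IH (residual-shorter 0<c) u′ v′ refl (ℕ.<-trans (residual-shorter 0<c) u+v<K))) ⟩
      (A - removalFactor c 0ℤ) + removalFactor c (coefficient (u′ ++ v′))
        ≡⟨ removalFactor-alternating c _ _ (cong coefficient ∘ no-fixed) coefficient-fixed ⟩
      coefficient (u ++ v) ∎
      where
      open ≡-Reasoning
      open Insertion u v
      A : ℤ
      A = removalFactor (suc c) (coefficient (u′ ++ v′))
      B : Letter → ℤ
      B L = removalFactor c (coefficient (u′ ++ L ∷ v′))

  marginal : ∀ u v → length u ℕ.+ length v < K →
    sumFin n (λ x → coefficient (u ++ letter x ∷ v)) ≡ coefficient (u ++ v)
  marginal u v = <-rec MarginalAt marginal-step _ u v refl

  word : ∀ {q} → (Fin q → Fin n) → Word
  word b = tabulate (letter ∘ b)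

  tensor : ∀ {q} → Tensor n q
  tensor b = coefficient (word b)

  tensor-resp-≗ : ∀ {q} → tensor {q} Preserves _≗_ ⟶ _≡_
  tensor-resp-≗ b≗b′ = cong coefficient (tabulate-cong (cong letter ∘ b≗b′))

  word-insertAt : ∀ {q} (t : Fin q → Fin n) r x →
    word (insertAt t r x) ≡ take (toℕ r) (word t) ++ letter x ∷ drop (toℕ r) (word t)
  word-insertAt t zero x = refl
  word-insertAt {suc q} t (suc r) x = cong (letter (t zero) ∷_) (word-insertAt (t ∘ suc) r x)

  word-duplicate : ∀ {q} (b : Fin q → Fin n) {i j} → i ≢ j → b i ≡ b j → HasDuplicate (word b)
  word-duplicate b {zero}  {zero}  i≢j _     = ⊥-elim (i≢j refl)
  word-duplicate b {zero}  {suc j} _   bi≡bj =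
    head∈tail (subst (_∈ word (b ∘ suc)) (cong letter (sym bi≡bj)) (∈-tabulate⁺ j))
  word-duplicate b {suc i} {zero}  _   bi≡bj =
    head∈tail (subst (_∈ word (b ∘ suc)) (cong letter bi≡bj) (∈-tabulate⁺ i))
  word-duplicate b {suc i} {suc j} i≢j bi≡bj = in-tail (word-duplicate (b ∘ suc) (i≢j ∘ cong suc) bi≡bj)

  tensor-hollow : ∀ {q} → IsHollow (tensor {q})
  tensor-hollow b (i , j , i≢j , bi≡bj) = coefficient-duplicate (word b) (word-duplicate b i≢j bi≡bj)

  tensor-marginal : ∀ {q} → q < K → ∀ (t : Fin q → Fin n) r →
    sumFin n (λ x → tensor (insertAt t r x)) ≡ tensor t
  tensor-marginal {q} q<K t r = begin
    sumFin n (λ x → tensor (insertAt t r x))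
      ≡⟨ sumFin-cong n (λ x → cong coefficient (word-insertAt t r x)) ⟩
    sumFin n (λ x → coefficient (take k (word t) ++ letter x ∷ drop k (word t)))
      ≡⟨ marginal (take k (word t)) (drop k (word t)) (subst (_< K) (sym length-split) q<K) ⟩
    coefficient (take k (word t) ++ drop k (word t))
      ≡⟨ cong coefficient (take++drop≡id k (word t)) ⟩
    tensor t ∎
    where
    open ≡-Reasoning
    k = toℕ r
    length-split : length (take k (word t)) ℕ.+ length (drop k (word t)) ≡ q
    length-split = trans (sym (length-++ (take k (word t))))
                         (trans (cong length (take++drop≡id k (word t))) (length-tabulate (letter ∘ t)))

  tensor-affine : ∀ q → q ≤ K → IsAffine (tensor {q})
  tensor-affine zero    _   = refl
  tensor-affine (suc q) q<K = begin
    sumTuples n (suc q) tensor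
      ≡⟨ sumTuples-insertAt q zero tensor tensor-resp-≗ ⟩
    sumFin n (λ x → sumTuples n q (λ t → tensor (insertAt t zero x)))
      ≡⟨ sumFin-sumTuples-comm n q _ ⟩
    sumTuples n q (λ t → sumFin n (λ x → tensor (insertAt t zero x)))
      ≡⟨ sumTuples-cong q (λ t → tensor-marginal q<K t zero) ⟩
    sumTuples n q tensor
      ≡⟨ tensor-affine q (ℕ.<⇒≤ q<K) ⟩
    1ℤ ∎
    where open ≡-Reasoning

  proj-tensor : ∀ {m} → m < K → (i : Fin m → Fin (suc m)) → StrictlyIncreasing i →
    ∀ a → proj i tensor a ≡ tensor a
  proj-tensor m<K i i↑ a = let r , i≗punchIn = strictlyIncreasing⇒punchIn i i↑ in begin
    proj i tensor a                          ≡⟨ proj-cong tensor i≗punchIn a ⟩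
    proj (punchIn r) tensor a                ≡⟨ proj-punchIn tensor tensor-resp-≗ r a ⟩
    sumFin n (λ x → tensor (insertAt a r x)) ≡⟨ tensor-marginal m<K a r ⟩
    tensor a                                 ∎
    where open ≡-Reasoning

  tensor-crystal : ∀ {q} → q ≤ K → IsCrystal (q ∸ 1) (tensor {q})
  tensor-crystal {zero}  _   i j _  _  a = proj-cong {i = i} {j} tensor (λ ()) a
  tensor-crystal {suc m} m<K i j i↑ j↑ a = trans (proj-tensor m<K i i↑ a) (sym (proj-tensor m<K j j↑ a))

-- An alphabet of triangular size

triangular : ℕ → ℕ
triangular zero    = 0
triangular (suc k) = triangular k ℕ.+ suc k

triangular-closed : ∀ k → (k * suc k) / 2 ≡ triangular k
triangular-closed k = trans (cong (_/ 2) (sym (triangular-double k))) (m*n/n≡m (triangular k) 2)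
  where
  step : ∀ k → k * suc k ℕ.+ suc k * 2 ≡ suc k * suc (suc k)
  step = ℕ-Solver.solve-∀
  triangular-double : ∀ k → triangular k * 2 ≡ k * suc k
  triangular-double zero    = refl
  triangular-double (suc k) = trans (ℕ.*-distribʳ-+ 2 (triangular k) (suc k))
                                    (trans (cong (ℕ._+ suc k * 2) (triangular-double k)) (step k))

topLetter : ∀ k → Fin (suc k) → Letter
topLetter k p = suc k , toℕ p

letter : ∀ k → Fin (triangular k) → Letter
letter (suc k) x = [ letter k , topLetter k ]′ (splitAt (triangular k) x)

letter-level : ∀ k x → level (letter k x) ≤ k
letter-level (suc k) x with splitAt (triangular k) x
... | inj₁ y = ℕ.m≤n⇒m≤1+n (letter-level k y)
... | inj₂ _ = ℕ.≤-refl

letter-injective : ∀ k → Injective _≡_ _≡_ (letter k)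
letter-injective (suc k) {x} {y} eq = begin
  x                                                      ≡⟨ join-splitAt (triangular k) (suc k) x ⟨
  join (triangular k) (suc k) (splitAt (triangular k) x) ≡⟨ cong (join (triangular k) (suc k)) split-eq ⟩
  join (triangular k) (suc k) (splitAt (triangular k) y) ≡⟨ join-splitAt (triangular k) (suc k) y ⟩
  y                                                      ∎
  where
  open ≡-Reasoning
  letter≢topLetter : ∀ y p → letter k y ≢ topLetter k p
  letter≢topLetter y p eq = ℕ.1+n≰n (subst (_≤ k) (cong level eq) (letter-level k y))
  blocks-injective : ∀ s s′ → [ letter k , topLetter k ]′ s ≡ [ letter k , topLetter k ]′ s′ → s ≡ s′
  blocks-injective (inj₁ y) (inj₁ y′) eq = cong inj₁ (letter-injective k eq)
  blocks-injective (inj₁ y) (inj₂ p′) eq = ⊥-elim (letter≢topLetter y p′ eq)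
  blocks-injective (inj₂ p) (inj₁ y′) eq = ⊥-elim (letter≢topLetter y′ p (sym eq))
  blocks-injective (inj₂ p) (inj₂ p′) eq = cong inj₂ (toℕ-injective (cong proj₂ eq))
  split-eq : splitAt (triangular k) x ≡ splitAt (triangular k) y
  split-eq = blocks-injective (splitAt (triangular k) x) (splitAt (triangular k) y) eq

letter-onto : ∀ k {ℓ p} → p < ℓ → ℓ ≤ k → ∃[ x ] letter k x ≡ (ℓ , p)
letter-onto zero    p<ℓ ℓ≤0 = ⊥-elim (ℕ.n≮0 (ℕ.<-≤-trans p<ℓ ℓ≤0))
letter-onto (suc k) p<ℓ ℓ≤1+k with ℕ.m≤n⇒m<n∨m≡n ℓ≤1+k
... | inj₁ ℓ≤k = let x , x↦ = letter-onto k p<ℓ (ℕ.≤-pred ℓ≤k) in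
  x ↑ˡ suc k , trans (cong [ letter k , topLetter k ]′ (splitAt-↑ˡ (triangular k) x (suc k))) x↦
... | inj₂ refl =
  triangular k ↑ʳ fromℕ< p<ℓ ,
  trans (cong [ letter k , topLetter k ]′ (splitAt-↑ʳ (triangular k) (suc k) (fromℕ< p<ℓ)))
        (cong (suc k ,_) (toℕ-fromℕ< p<ℓ))

theorem2p5 : (k : ℕ) →
    Σ (Tensor ((k * suc k) / 2) k) (λ C → IsHollow C × IsAffine C × IsCrystal (k ∸ 1) C)
theorem2p5 k = subst (λ n → Σ (Tensor n k) (λ C → IsHollow C × IsAffine C × IsCrystal (k ∸ 1) C))
  (sym (triangular-closed k))
  (tensor , tensor-hollow , tensor-affine k ℕ.≤-refl , tensor-crystal ℕ.≤-refl)
  where open FromAlphabet (letter k) (letter-injective k) (letter-onto k)
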